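{- Let $V$ be a finite set of nodes with metric edge weights $c$. Let $T$ be a minimum spanning tree on $V$. Let $V_b \cup V_r = V$ be any 2-coloring of $V$, and let $T_b$ and $T_r$ be minimum spanning trees of $V_b$ and $V_r$, respectively. Let $e_\times=\{v_L,v_R\}$ be a heaviest edge of $T$, with weight $w_\times$. Let $T_L,T_R$ be the trees (on node sets $V_L,V_R$, respectively) obtained by deleting $e_\times$ from $T$, where $v_L\in T_L$ and $v_R\in T_R$. Let $w_L,w_R$ be the heaviest edge weights appearing in $T_L,T_R$, respectively. Then (a) $c(T_b)+c(T_r) \le 3c(T)-(w_L+w_\times+w_R)$, and (b) $\max\{c(T_b),c(T_r)\} \le 2c(T)-(w_L+w_\times+w_R)$. Moreover, if all nodes of $T_L$ are blue (i.e., $V_L\subseteq V_b$), then (c) $c(T_b)+c(T_r) \le c(T_L)+w_\times+(3c(T_R)-w_R)$, and (d) $\max\{c(T_b),c(T_r)\} \le c(T_L)+w_\times+(2c(T_R)-w_R)$.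
   Context: The weight function $c$ is defined on all pairs of nodes (complete graph), nonnegative and satisfying the triangle inequality. For a set of edges $F$, $c(F)$ is the total weight of $F$. A 2-coloring here is an arbitrary partition of $V$ into blue nodes $V_b$ and red nodes $V_r$.
   Formalization: The metric edge weights $c$ take rational values. -}

module Defs where

open import Data.Nat using (ℕ; _∸_)
open import Data.Fin using (Fin) renaming (_<_ to _<ᶠ_)
open import Data.Fin.Subset using (Subset; _∈_; ∣_∣)
open import Data.Product using (Σ; _×_; _,_; proj₁; proj₂)
open import Data.Sum using (_⊎_)
open import Data.List using (List; []; _∷_; length; foldr; map)
open import Data.List.Relation.Unary.Unique.Propositional using (Unique)
import Data.List.Membership.Propositional as LM
open import Data.Integer using (+_)
open import Data.Rational using (ℚ; 0ℚ; _+_; _≤_; _⊔_; _/_)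
open import Relation.Binary.PropositionalEquality using (_≡_)

-- A weight function on all pairs of nodes of V = Fin n (complete graph).
Weight : ℕ → Set
Weight n = Fin n → Fin n → ℚ

record IsMetric {n : ℕ} (c : Weight n) : Set where
  field
    nonneg   : ∀ u v → 0ℚ ≤ c u v
    symm     : ∀ u v → c u v ≡ c v u
    diag     : ∀ u → c u u ≡ 0ℚ
    triangle : ∀ u v w → c u w ≤ c u v + c v w

-- An (undirected) edge {u,v}, represented canonically with u < v.
Edge : ℕ → Set
Edge n = Σ (Fin n × Fin n) λ p → proj₁ p <ᶠ proj₂ p

end₁ end₂ : ∀ {n} → Edge n → Fin n
end₁ e = proj₁ (proj₁ e)
end₂ e = proj₂ (proj₁ e)

w : ∀ {n} → Weight n → Edge n → ℚ
w c e = c (end₁ e) (end₂ e)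

cost : ∀ {n} → Weight n → List (Edge n) → ℚ
cost c F = foldr _+_ 0ℚ (map (w c) F)

-- heaviest edge weight in F (0 for the empty edge set; weights are nonnegative)
maxW : ∀ {n} → Weight n → List (Edge n) → ℚ
maxW c F = foldr _⊔_ 0ℚ (map (w c) F)

Joins : ∀ {n} → Edge n → Fin n → Fin n → Set
Joins e u v = (end₁ e ≡ u × end₂ e ≡ v) ⊎ (end₁ e ≡ v × end₂ e ≡ u)

data Reach {n : ℕ} (F : List (Edge n)) : Fin n → Fin n → Set where
  here : ∀ {u} → Reach F u u
  step : ∀ {u x v} (e : Edge n) → e LM.∈ F → Joins e u x → Reach F x v → Reach F u v

-- F is a spanning tree on the node set S: a set of edges among S that
-- connects S and has exactly |S| - 1 edges (equivalently: connected and acyclic).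
record SpanningTree {n : ℕ} (S : Subset n) (F : List (Edge n)) : Set where
  field
    inside₁   : ∀ e → e LM.∈ F → end₁ e ∈ S
    inside₂   : ∀ e → e LM.∈ F → end₂ e ∈ S
    distinct  : Unique F
    edgeCount : length F ≡ ∣ S ∣ ∸ 1
    connected : ∀ u v → u ∈ S → v ∈ S → Reach F u v

record MST {n : ℕ} (c : Weight n) (S : Subset n) (F : List (Edge n)) : Set where
  field
    tree    : SpanningTree S F
    minimal : ∀ F' → SpanningTree S F' → cost c F ≤ cost c F'

3ℚ 2ℚ : ℚ
3ℚ = + 3 / 1
2ℚ = + 2 / 1

module Submission where

-- The bounds hold for any spanning tree T split by an edge e×
-- into spanning trees TL, TR; minimality of T and heaviness of e× are unused.
-- For an edge list F, a root u and a colour X, a "piece" is a spanning tree on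
-- the nodes of X reachable from u, with two ports p, q; relative to u it costs
-- link₂ = c(tree) + c(u,p) + c(u,q) or link₁ = c(tree) + c(u,p).  By induction
-- on F ('bounds'): for covering colours X, Y and any edge g of F there are
-- pieces with link₂(X) + link₂(Y) ≤ 3c(F), link₁(X) + link₁(Y) + c(g) ≤ 3c(F),
-- and for one colour with 2c(F).  The step removes an edge {u,y}; if it is a
-- bridge the pieces of both sides are glued by an edge between ports, paid for
-- by the triangle inequality through u and y ('Merge').  Finally the pieces of
-- TL and TR are joined through e× into spanning trees of Vb and its complement;
-- taking g heaviest in TL and in TR gives (a)–(d).

open import Defs
open import Data.Nat as ℕ using (ℕ; suc; _∸_)
import Data.Nat.Properties as ℕP
open import Data.Fin using (Fin; zero; suc; _≟_)
open import Data.Fin.Properties using (<-cmp)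
open import Data.Fin.Subset using (Subset; ⊤; ∁; _∈_; _⊆_; _∩_; _∪_; ⊥; ⁅_⁆; ∣_∣; inside; outside)
open import Data.Fin.Subset.Properties
  using (∉⊥; ∣⊥∣≡0; ∈⊤; x∈⁅x⁆; x∈⁅y⁆⇒x≡y; ∣⁅x⁆∣≡1; ⊆-antisym; x∈∁p⇒x∉p; x∉p⇒x∈∁p;
         x∈p∩q⁺; x∈p∪q⁻; x∈p∪q⁺; _∈?_)
open import Data.Vec.Base using (_∷_; []) renaming (here to vhere; there to vthere)
open import Data.Product using (Σ; ∃-syntax; _×_; _,_; proj₁; proj₂)
open import Data.Sum using (_⊎_; inj₁; inj₂; [_,_])
open import Data.Empty using (⊥-elim) renaming (⊥ to Void)
open import Data.List using (List; []; _∷_; _++_; length; filter)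
import Data.List.Properties as List
open import Data.List.Membership.Propositional using () renaming (_∈_ to _∈ₗ_)
open import Data.List.Membership.Propositional.Properties
  using (∈-++⁺ˡ; ∈-++⁺ʳ; ∈-++⁻; ∈-∃++; ∈-filter⁺; ∈-filter⁻)
open import Data.List.Relation.Unary.Any using (here; there)
import Data.List.Relation.Unary.All as All
open import Data.List.Relation.Unary.AllPairs using (_∷_; [])
import Data.List.Relation.Unary.Unique.Propositional.Properties as Unique
open import Data.List.Relation.Binary.Permutation.Propositional using (_↭_; ↭-sym; ↭⇒↭ₛ)
open import Data.List.Relation.Binary.Permutation.Propositional.Properties
  using (∈-resp-↭; map⁺) renaming (shift to ↭-shift)
import Data.List.Relation.Binary.Permutation.Setoid.Properties as Permutationₛ
open import Data.Rational using (ℚ; 0ℚ; 1ℚ; _+_; _-_; -_; _*_; _≤_; _⊔_)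
open import Data.Rational.Properties
  using (≤-refl; ≤-trans; ≤-reflexive; +-mono-≤; +-monoˡ-≤; +-monoʳ-≤; ⊔-lub; ⊔-sel;
         +-assoc; +-comm; +-identityˡ; +-identityʳ; +-inverseʳ; *-distribˡ-+; *-distribʳ-+;
         *-identityˡ; +-0-isCommutativeMonoid; +-*-commutativeRing; module ≤-Reasoning)
open import Relation.Binary.PropositionalEquality
  using (_≡_; _≢_; refl; sym; trans; cong; cong₂; subst; subst₂; setoid; module ≡-Reasoning)
open import Relation.Binary.Definitions using (tri<; tri≈; tri>)
open import Relation.Nullary using (¬_; Dec; yes; no; ¬?)
open import Relation.Nullary.Decidable using (map′; _×-dec_; _⊎-dec_)
open import Data.Maybe using (nothing)
open import Tactic.RingSolver using (solve-∀)
import Tactic.RingSolver.Core.AlmostCommutativeRing as ACR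

ℚ-ring : ACR.AlmostCommutativeRing _ _
ℚ-ring = ACR.fromCommutativeRing +-*-commutativeRing (λ _ → nothing)

x≤x+y : ∀ x {y} → 0ℚ ≤ y → x ≤ x + y
x≤x+y x {y} 0≤y = ≤-trans (≤-reflexive (sym (+-identityʳ x))) (+-monoʳ-≤ x 0≤y)

x≤y+x : ∀ x {y} → 0ℚ ≤ y → x ≤ y + x
x≤y+x x {y} 0≤y = ≤-trans (x≤x+y x 0≤y) (≤-reflexive (+-comm x y))

≤-minus : ∀ a b {d} → a + b ≤ d → a ≤ d - b
≤-minus a b {d} h = begin
  a               ≡⟨ sym (trans (+-assoc a b (- b)) (trans (cong (a +_) (+-inverseʳ b)) (+-identityʳ a))) ⟩
  (a + b) - b     ≤⟨ +-monoˡ-≤ (- b) h ⟩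
  d - b           ∎
  where open ≤-Reasoning

two : ∀ x → 2ℚ * x ≡ x + x
two x = trans (*-distribʳ-+ x 1ℚ 1ℚ) (cong₂ _+_ (*-identityˡ x) (*-identityˡ x))

three : ∀ x → 3ℚ * x ≡ x + x + x
three x = trans (*-distribʳ-+ x (1ℚ + 1ℚ) 1ℚ) (cong₂ _+_ (two x) (*-identityˡ x))

budget : ∀ m {d a b D A B} → D ≤ m * d → A ≤ m * a → B ≤ m * b → D + (A + B) ≤ m * (d + (a + b))
budget m {d} {a} {b} hD hA hB = ≤-trans (+-mono-≤ hD (+-mono-≤ hA hB))
  (≤-reflexive (sym (trans (*-distribˡ-+ m d (a + b)) (cong (m * d +_) (*-distribˡ-+ m a b)))))

pair-sum : ∀ d₀ a₀ b₀ d₁ a₁ b₁ → (d₀ + (a₀ + b₀)) + (d₁ + (a₁ + b₁)) ≡ (d₀ + d₁) + ((a₀ + a₁) + (b₀ + b₁))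
pair-sum = solve-∀ ℚ-ring

absorb-left : ∀ d a b t → (d + (a + b)) + t ≡ d + ((a + t) + b)
absorb-left = solve-∀ ℚ-ring

absorb-right : ∀ d a b t e → (d + (a + b)) + (t + e) ≡ (d + e) + (a + (b + t))
absorb-right = solve-∀ ℚ-ring

-- The shape of a merge bound when the second side is empty: x ≤ y gives
-- x ≤ d + (y + 0) for d ≥ 0.
≤-pad : ∀ {x y d} → 0ℚ ≤ d → x ≤ y → x ≤ d + (y + 0ℚ)
≤-pad {x} {y} {d} 0≤d x≤y = ≤-trans x≤y (≤-trans (x≤y+x y 0≤d) (≤-reflexive (cong (d +_) (sym (+-identityʳ y)))))

≤-double : ∀ {x} → 0ℚ ≤ x → x ≤ 2ℚ * x
≤-double {x} 0≤x = ≤-trans (x≤x+y x 0≤x) (≤-reflexive (sym (two x)))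

≤-triple : ∀ {x} → 0ℚ ≤ x → x ≤ 3ℚ * x
≤-triple {x} 0≤x = ≤-trans (x≤x+y x (+-mono-≤ 0≤x 0≤x)) (≤-reflexive (trans (sym (+-assoc x x x)) (sym (three x))))

grow-budget : ∀ m {x C d} → 0ℚ ≤ m * d → x ≤ m * C → x ≤ m * (d + C)
grow-budget m {x} {C} {d} 0≤md h =
  ≤-trans h (≤-trans (x≤y+x (m * C) 0≤md) (≤-reflexive (sym (*-distribˡ-+ m d C))))

grow-budget′ : ∀ m {x t t′ C d} → d ≤ m * d → x + t′ ≤ m * C → t ≤ t′ + d → x + t ≤ m * (d + C)
grow-budget′ m {x} {t} {t′} {C} {d} d≤md h ht = begin
  x + t                 ≤⟨ +-monoʳ-≤ x ht ⟩
  x + (t′ + d)          ≡⟨ sym (+-assoc x t′ d) ⟩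
  (x + t′) + d          ≤⟨ +-mono-≤ h d≤md ⟩
  m * C + m * d         ≡⟨ trans (+-comm (m * C) (m * d)) (sym (*-distribˡ-+ m d C)) ⟩
  m * (d + C)           ∎
  where open ≤-Reasoning

joins-sym : ∀ {n} {e : Edge n} {a b} → Joins e a b → Joins e b a
joins-sym (inj₁ (p , q)) = inj₂ (p , q)
joins-sym (inj₂ (p , q)) = inj₁ (p , q)

EndOf : ∀ {n} → Edge n → Fin n → Set
EndOf e a = end₁ e ≡ a ⊎ end₂ e ≡ a

joins-ends : ∀ {n} {e : Edge n} {a b} → Joins e a b → EndOf e a × EndOf e b
joins-ends (inj₁ (p , q)) = inj₁ p , inj₂ q
joins-ends (inj₂ (p , q)) = inj₂ q , inj₁ p

module _ {n : ℕ} where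

  walk-++ : ∀ {F : List (Edge n)} {x y z} → Reach F x y → Reach F y z → Reach F x z
  walk-++ here q = q
  walk-++ (step e e∈ j r) q = step e e∈ j (walk-++ r q)

  walk-edge : ∀ {F : List (Edge n)} {e x y} → e ∈ₗ F → Joins e x y → Reach F x y
  walk-edge e∈ j = step _ e∈ j here

  walk-snoc : ∀ {F : List (Edge n)} {e x y z} → Reach F x y → e ∈ₗ F → Joins e y z → Reach F x z
  walk-snoc r e∈ j = walk-++ r (walk-edge e∈ j)

  walk-sym : ∀ {F : List (Edge n)} {x y} → Reach F x y → Reach F y x
  walk-sym here = here
  walk-sym (step e e∈ j r) = walk-snoc (walk-sym r) e∈ (joins-sym {e = e} j)

  walk-mono : ∀ {F G : List (Edge n)} → (∀ {g} → g ∈ₗ F → g ∈ₗ G) → ∀ {x y} → Reach F x y → Reach G x y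
  walk-mono F⊆G here = here
  walk-mono F⊆G (step e e∈ j r) = step e (F⊆G e∈) j (walk-mono F⊆G r)

  walk-invariant : ∀ {F : List (Edge n)} (Q : Fin n → Set) →
                   (∀ {g a b} → g ∈ₗ F → Joins g a b → Q a → Q b) → ∀ {x y} → Q x → Reach F x y → Q y
  walk-invariant Q step-Q qx here = qx
  walk-invariant Q step-Q qx (step e e∈ j r) = walk-invariant Q step-Q (step-Q e∈ j qx) r

  walk-inside : ∀ {F : List (Edge n)} {S : Subset n} → (∀ g → g ∈ₗ F → end₁ g ∈ S) →
                (∀ g → g ∈ₗ F → end₂ g ∈ S) → ∀ {x y} → x ∈ S → Reach F x y → y ∈ S
  walk-inside {F} {S} in₁ in₂ = walk-invariant (_∈ S) preserve
    where
    preserve : ∀ {g a b} → g ∈ₗ F → Joins g a b → a ∈ S → b ∈ S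
    preserve {g} g∈ (inj₁ (_ , refl)) _ = in₂ g g∈
    preserve {g} g∈ (inj₂ (refl , _)) _ = in₁ g g∈

  walk-isolated : ∀ {F : List (Edge n)} {u} → (∀ g → g ∈ₗ F → ¬ EndOf g u) → ∀ {v} → Reach F u v → u ≡ v
  walk-isolated {F} {u} untouched = walk-invariant (u ≡_) preserve refl
    where
    preserve : ∀ {g a b} → g ∈ₗ F → Joins g a b → u ≡ a → u ≡ b
    preserve {g} g∈ j refl = ⊥-elim (untouched g g∈ (proj₁ (joins-ends {e = g} j)))

  walk-confine : ∀ {G H : List (Edge n)} {r} → (∀ {g} → g ∈ₗ G → Reach G r (end₁ g) → g ∈ₗ H) →
                 ∀ {v} → Reach G r v → Reach H r v
  walk-confine {G} {H} {r} inH rv = proj₂ (walk-invariant Q preserve (here , here) rv)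
    where
    Q : Fin n → Set
    Q v = Reach G r v × Reach H r v
    first-end : ∀ {g a b} → Joins g a b → Reach G r a → Reach G r b → Reach G r (end₁ g)
    first-end (inj₁ (refl , _)) ra _ = ra
    first-end (inj₂ (refl , _)) _ rb = rb
    preserve : ∀ {g a b} → g ∈ₗ G → Joins g a b → Q a → Q b
    preserve {g} g∈ j (ra , ra′) = rb , walk-snoc ra′ (inH g∈ (first-end {g} j ra rb)) j
      where rb = walk-snoc ra g∈ j

  ToEnd : List (Edge n) → Fin n → Edge n → Set
  ToEnd G x e = Reach G x (end₁ e) ⊎ Reach G x (end₂ e)

  FromEnd : List (Edge n) → Edge n → Fin n → Set
  FromEnd G e v = Reach G (end₁ e) v ⊎ Reach G (end₂ e) v

  WalkVia : List (Edge n) → Edge n → Fin n → Fin n → Set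
  WalkVia G e x v = Reach G x v ⊎ (ToEnd G x e × FromEnd G e v)

  walk-via : ∀ {G : List (Edge n)} {e x v} → Reach (e ∷ G) x v → WalkVia G e x v
  walk-via {G} {e} {x} = walk-invariant (WalkVia G e x) preserve (inj₁ here)
    where
    toEnd : ∀ {a} → EndOf e a → Reach G x a → ToEnd G x e
    toEnd (inj₁ refl) r = inj₁ r
    toEnd (inj₂ refl) r = inj₂ r
    atEnd : ∀ {b} → EndOf e b → FromEnd G e b
    atEnd (inj₁ refl) = inj₁ here
    atEnd (inj₂ refl) = inj₂ here
    extend : ∀ {g a b} → g ∈ₗ G → Joins g a b → FromEnd G e a → FromEnd G e b
    extend g∈ j (inj₁ r) = inj₁ (walk-snoc r g∈ j)
    extend g∈ j (inj₂ r) = inj₂ (walk-snoc r g∈ j)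
    preserve : ∀ {g a b} → g ∈ₗ e ∷ G → Joins g a b → WalkVia G e x a → WalkVia G e x b
    preserve (here refl) j (inj₁ r) = inj₂ (toEnd (proj₁ (joins-ends {e = e} j)) r , atEnd (proj₂ (joins-ends {e = e} j)))
    preserve (here refl) j (inj₂ (t , _)) = inj₂ (t , atEnd (proj₂ (joins-ends {e = e} j)))
    preserve (there g∈) j (inj₁ r) = inj₁ (walk-snoc r g∈ j)
    preserve (there g∈) j (inj₂ (t , f)) = inj₂ (t , extend g∈ j f)

  via-walk : ∀ {G : List (Edge n)} {e x v} → WalkVia G e x v → Reach (e ∷ G) x v
  via-walk {G} {e} (inj₁ r) = walk-mono there r
  via-walk {G} {e} {x} {v} (inj₂ (t , f)) = walk-++ (toEnd₁ t) (fromEnd₁ f)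
    where
    across : Joins e (end₁ e) (end₂ e)
    across = inj₁ (refl , refl)
    toEnd₁ : ToEnd G x e → Reach (e ∷ G) x (end₁ e)
    toEnd₁ (inj₁ r) = walk-mono there r
    toEnd₁ (inj₂ r) = walk-snoc (walk-mono there r) (here refl) (joins-sym {e = e} across)
    fromEnd₁ : FromEnd G e v → Reach (e ∷ G) (end₁ e) v
    fromEnd₁ (inj₁ r) = walk-mono there r
    fromEnd₁ (inj₂ r) = step e (here refl) across (walk-mono there r)

  reachable? : ∀ (G : List (Edge n)) x v → Dec (Reach G x v)
  reachable? [] x v with x ≟ v
  ... | yes refl = yes here
  ... | no x≢v = no λ { here → x≢v refl ; (step _ () _ _) }
  reachable? (e ∷ G) x v = map′ via-walk walk-via
    (reachable? G x v ⊎-dec ((reachable? G x (end₁ e) ⊎-dec reachable? G x (end₂ e))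
                             ×-dec (reachable? G (end₁ e) v ⊎-dec reachable? G (end₂ e) v)))

Disjoint : ∀ {m} → Subset m → Subset m → Set
Disjoint p q = ∀ x → x ∈ p → x ∈ q → Void

∣∪∣-disjoint : ∀ {m} (p q : Subset m) → Disjoint p q → ∣ p ∪ q ∣ ≡ ∣ p ∣ ℕ.+ ∣ q ∣
∣∪∣-disjoint [] [] _ = refl
∣∪∣-disjoint (inside ∷ p) (inside ∷ q) d = ⊥-elim (d zero vhere vhere)
∣∪∣-disjoint (inside ∷ p) (outside ∷ q) d = cong suc (∣∪∣-disjoint p q (λ x a b → d (suc x) (vthere a) (vthere b)))
∣∪∣-disjoint (outside ∷ p) (inside ∷ q) d =
  trans (cong suc (∣∪∣-disjoint p q (λ x a b → d (suc x) (vthere a) (vthere b)))) (sym (ℕP.+-suc ∣ p ∣ ∣ q ∣))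
∣∪∣-disjoint (outside ∷ p) (outside ∷ q) d = ∣∪∣-disjoint p q (λ x a b → d (suc x) (vthere a) (vthere b))

nonempty-size : ∀ {m} {p : Subset m} {x} → x ∈ p → ∃[ k ] ∣ p ∣ ≡ suc k
nonempty-size vhere = _ , refl
nonempty-size {p = inside ∷ p} (vthere _) = _ , refl
nonempty-size {p = outside ∷ p} (vthere x∈p) = nonempty-size x∈p

module _ {n : ℕ} where

  edgeBetween : (a b : Fin n) → a ≢ b → Edge n
  edgeBetween a b a≢b with <-cmp a b
  ... | tri< a<b _ _ = (a , b) , a<b
  ... | tri≈ _ a≡b _ = ⊥-elim (a≢b a≡b)
  ... | tri> _ _ b<a = (b , a) , b<a

  edgeBetween-joins : ∀ a b a≢b → Joins (edgeBetween a b a≢b) a b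
  edgeBetween-joins a b a≢b with <-cmp a b
  ... | tri< _ _ _ = inj₁ (refl , refl)
  ... | tri≈ _ a≡b _ = ⊥-elim (a≢b a≡b)
  ... | tri> _ _ _ = inj₂ (refl , refl)

  tree-empty : SpanningTree (⊥ {n}) []
  tree-empty = record
    { inside₁ = λ _ () ; inside₂ = λ _ () ; distinct = []
    ; edgeCount = sym (cong (_∸ 1) (∣⊥∣≡0 n)) ; connected = λ _ _ u∈⊥ _ → ⊥-elim (∉⊥ u∈⊥) }

  tree-single : ∀ (v : Fin n) → SpanningTree ⁅ v ⁆ []
  tree-single v = record
    { inside₁ = λ _ () ; inside₂ = λ _ () ; distinct = []
    ; edgeCount = sym (cong (_∸ 1) (∣⁅x⁆∣≡1 v)) ; connected = connected }
    where
    connected : ∀ a b → a ∈ ⁅ v ⁆ → b ∈ ⁅ v ⁆ → Reach [] a b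
    connected a b a∈ b∈ with x∈⁅y⁆⇒x≡y v a∈ | x∈⁅y⁆⇒x≡y v b∈
    ... | refl | refl = here

  join-count : ∀ {S₁ S₂ : Subset n} {a b} → Disjoint S₁ S₂ → a ∈ S₁ → b ∈ S₂ → ∀ k₁ k₂ →
               k₁ ≡ ∣ S₁ ∣ ∸ 1 → k₂ ≡ ∣ S₂ ∣ ∸ 1 → suc (k₁ ℕ.+ k₂) ≡ ∣ S₁ ∪ S₂ ∣ ∸ 1
  join-count {S₁} {S₂} disjoint a∈ b∈ k₁ k₂ refl refl
    with nonempty-size a∈ | nonempty-size b∈
  ... | s₁ , eq₁ | s₂ , eq₂ = begin
    suc ((∣ S₁ ∣ ∸ 1) ℕ.+ (∣ S₂ ∣ ∸ 1))  ≡⟨ cong₂ (λ x y → suc ((x ∸ 1) ℕ.+ (y ∸ 1))) eq₁ eq₂ ⟩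
    suc (s₁ ℕ.+ s₂)                      ≡⟨ sym (ℕP.+-suc s₁ s₂) ⟩
    (suc s₁ ℕ.+ suc s₂) ∸ 1              ≡⟨ cong₂ (λ x y → (x ℕ.+ y) ∸ 1) (sym eq₁) (sym eq₂) ⟩
    (∣ S₁ ∣ ℕ.+ ∣ S₂ ∣) ∸ 1              ≡⟨ cong (_∸ 1) (sym (∣∪∣-disjoint S₁ S₂ disjoint)) ⟩
    ∣ S₁ ∪ S₂ ∣ ∸ 1                      ∎
    where open ≡-Reasoning

  tree-join : ∀ {S₁ S₂ : Subset n} {F₁ F₂ : List (Edge n)} → SpanningTree S₁ F₁ → SpanningTree S₂ F₂ →
              Disjoint S₁ S₂ → ∀ {a b} → a ∈ S₁ → b ∈ S₂ → (a≢b : a ≢ b) →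
              SpanningTree (S₁ ∪ S₂) (edgeBetween a b a≢b ∷ F₁ ++ F₂)
  tree-join {S₁} {S₂} {F₁} {F₂} T₁ T₂ disjoint {a} {b} a∈ b∈ a≢b = record
    { inside₁ = ends-inside T₁.inside₁ T₂.inside₁ (proj₁ ends)
    ; inside₂ = ends-inside T₁.inside₂ T₂.inside₂ (proj₂ ends)
    ; distinct = All.tabulate new ∷ Unique.++⁺ T₁.distinct T₂.distinct
                   (λ { (g∈₁ , g∈₂) → disjoint _ (T₁.inside₁ _ g∈₁) (T₂.inside₁ _ g∈₂) })
    ; edgeCount = trans (cong suc (List.length-++ F₁))
                    (join-count disjoint a∈ b∈ (length F₁) (length F₂) T₁.edgeCount T₂.edgeCount)
    ; connected = connected }
    where
    module T₁ = SpanningTree T₁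
    module T₂ = SpanningTree T₂
    e = edgeBetween a b a≢b
    joins = edgeBetween-joins a b a≢b
    ends : (end₁ e ≡ a ⊎ end₁ e ≡ b) × (end₂ e ≡ a ⊎ end₂ e ≡ b)
    ends with joins
    ... | inj₁ (p , q) = inj₁ p , inj₂ q
    ... | inj₂ (p , q) = inj₂ p , inj₁ q
    ends-inside : ∀ {end : Edge n → Fin n} → (∀ g → g ∈ₗ F₁ → end g ∈ S₁) → (∀ g → g ∈ₗ F₂ → end g ∈ S₂) →
             (end e ≡ a ⊎ end e ≡ b) → ∀ g → g ∈ₗ e ∷ F₁ ++ F₂ → end g ∈ S₁ ∪ S₂
    ends-inside _ _ (inj₁ eq) g (here refl) = x∈p∪q⁺ (inj₁ (subst (_∈ S₁) (sym eq) a∈))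
    ends-inside _ _ (inj₂ eq) g (here refl) = x∈p∪q⁺ (inj₂ (subst (_∈ S₂) (sym eq) b∈))
    ends-inside in₁ in₂ _ g (there g∈) = x∈p∪q⁺ ([ (λ p → inj₁ (in₁ g p)) , (λ p → inj₂ (in₂ g p)) ] (∈-++⁻ F₁ g∈))
    -- the new edge crosses from S₁ to S₂, so it is in neither tree
    new : ∀ {g} → g ∈ₗ F₁ ++ F₂ → e ≢ g
    new g∈ refl with ∈-++⁻ F₁ g∈ | joins
    ... | inj₁ p | inj₁ (_ , q) = disjoint b (subst (_∈ S₁) q (T₁.inside₂ e p)) b∈
    ... | inj₁ p | inj₂ (q , _) = disjoint b (subst (_∈ S₁) q (T₁.inside₁ e p)) b∈
    ... | inj₂ p | inj₁ (q , _) = disjoint a a∈ (subst (_∈ S₂) q (T₂.inside₁ e p))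
    ... | inj₂ p | inj₂ (_ , q) = disjoint a a∈ (subst (_∈ S₂) q (T₂.inside₂ e p))
    left : ∀ {x y} → Reach F₁ x y → Reach (e ∷ F₁ ++ F₂) x y
    left = walk-mono (λ g∈ → there (∈-++⁺ˡ g∈))
    right : ∀ {x y} → Reach F₂ x y → Reach (e ∷ F₁ ++ F₂) x y
    right = walk-mono (λ g∈ → there (∈-++⁺ʳ F₁ g∈))
    cross : ∀ {x y} → x ∈ S₁ → y ∈ S₂ → Reach (e ∷ F₁ ++ F₂) x y
    cross x∈ y∈ = walk-++ (left (T₁.connected _ _ x∈ a∈)) (step e (here refl) joins (right (T₂.connected _ _ b∈ y∈)))
    connected : ∀ x y → x ∈ S₁ ∪ S₂ → y ∈ S₁ ∪ S₂ → Reach (e ∷ F₁ ++ F₂) x y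
    connected x y x∈ y∈ with x∈p∪q⁻ S₁ S₂ x∈ | x∈p∪q⁻ S₁ S₂ y∈
    ... | inj₁ p | inj₁ q = left (T₁.connected _ _ p q)
    ... | inj₂ p | inj₂ q = right (T₂.connected _ _ p q)
    ... | inj₁ p | inj₂ q = cross p q
    ... | inj₂ p | inj₁ q = walk-sym (cross q p)

module WithMetric {n : ℕ} (c : Weight n) (metric : IsMetric c) where
  open IsMetric metric

  weight-joins : ∀ {e : Edge n} {a b} → Joins e a b → w c e ≡ c a b
  weight-joins (inj₁ (refl , refl)) = refl
  weight-joins (inj₂ (refl , refl)) = symm _ _

  weight-nonneg : ∀ e → 0ℚ ≤ w c e
  weight-nonneg e = nonneg _ _

  cost-nonneg : ∀ F → 0ℚ ≤ cost c F
  cost-nonneg [] = ≤-refl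
  cost-nonneg (e ∷ F) = +-mono-≤ (weight-nonneg e) (cost-nonneg F)

  cost-++ : ∀ F G → cost c (F ++ G) ≡ cost c F + cost c G
  cost-++ [] G = sym (+-identityˡ (cost c G))
  cost-++ (e ∷ F) G = trans (cong (w c e +_) (cost-++ F G)) (sym (+-assoc (w c e) (cost c F) (cost c G)))

  cost-↭ : ∀ {F G} → F ↭ G → cost c F ≡ cost c G
  cost-↭ F↭G = Permutationₛ.foldr-commMonoid (setoid ℚ) +-0-isCommutativeMonoid (↭⇒↭ₛ (map⁺ (w c) F↭G))

  weight≤cost : ∀ {e F} → e ∈ₗ F → w c e ≤ cost c F
  weight≤cost {F = g ∷ F} (here refl) = x≤x+y (w c g) (cost-nonneg F)
  weight≤cost {F = g ∷ F} (there e∈) = ≤-trans (weight≤cost e∈) (x≤y+x (cost c F) (weight-nonneg g))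

  cost-filter : ∀ {P : Edge n → Set} (P? : ∀ g → Dec (P g)) F →
                cost c F ≡ cost c (filter P? F) + cost c (filter (λ g → ¬? (P? g)) F)
  cost-filter P? [] = refl
  cost-filter P? (e ∷ F) with P? e
  ... | yes _ = trans (cong (w c e +_) (cost-filter P? F)) (sym (+-assoc (w c e) (cost c kept) (cost c dropped)))
    where
    kept = filter P? F
    dropped = filter (λ g → ¬? (P? g)) F
  ... | no _ = trans (cong (w c e +_) (cost-filter P? F)) (swap-front (w c e) (cost c kept) (cost c dropped))
    where
    kept = filter P? F
    dropped = filter (λ g → ¬? (P? g)) F
    swap-front : ∀ a b d → a + (b + d) ≡ b + (a + d)
    swap-front = solve-∀ ℚ-ring

  data OptEdge (F : List (Edge n)) : Set where
    none : OptEdge F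
    some : (g : Edge n) → g ∈ₗ F → OptEdge F

  wt : ∀ {F} → OptEdge F → ℚ
  wt none = 0ℚ
  wt (some g _) = w c g

  heaviest : ∀ F → Σ (OptEdge F) λ g → wt g ≡ maxW c F
  heaviest [] = none , refl
  heaviest (e ∷ F) with ⊔-sel (w c e) (maxW c F) | heaviest F
  ... | inj₁ eq | _ = some e (here refl) , sym eq
  ... | inj₂ eq | none , eq′ = none , trans eq′ (sym eq)
  ... | inj₂ eq | some g g∈ , eq′ = some g (there g∈) , trans eq′ (sym eq)

  via : ∀ u y a b → c a b ≤ c u a + (c u y + c y b)
  via u y a b = begin
    c a b                    ≤⟨ triangle a u b ⟩
    c a u + c u b            ≤⟨ +-mono-≤ (≤-reflexive (symm a u)) (triangle u y b) ⟩
    c u a + (c u y + c y b)  ∎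
    where open ≤-Reasoning

  record Piece (P : Fin n → Set) (r : Fin n) : Set where
    field
      nodes    : Subset n
      edges    : List (Edge n)
      tree     : SpanningTree nodes edges
      sound    : ∀ {v} → v ∈ nodes → P v
      complete : ∀ {v} → P v → v ∈ nodes
      port₁    : Fin n
      port₂    : Fin n
      port₁∈   : port₁ ∈ nodes
      port₂∈   : port₂ ∈ nodes
      anchored : P r → port₁ ≡ r × port₂ ≡ r

  Absent : (Fin n → Set) → Set
  Absent P = ∀ {v} → P v → Void

  State : (Fin n → Set) → Fin n → Set
  State P r = Absent P ⊎ Piece P r

  edgesOf : ∀ {P r} → State P r → List (Edge n)
  edgesOf (inj₁ _) = []
  edgesOf (inj₂ π) = Piece.edges π

  link₂ : ∀ {P r} → Fin n → State P r → ℚ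
  link₂ x (inj₁ _) = 0ℚ
  link₂ x (inj₂ π) = cost c (Piece.edges π) + c x (Piece.port₁ π) + c x (Piece.port₂ π)

  link₁ : ∀ {P r} → Fin n → State P r → ℚ
  link₁ x (inj₁ _) = 0ℚ
  link₁ x (inj₂ π) = cost c (Piece.edges π) + c x (Piece.port₁ π)

  link₁≤link₂ : ∀ {P r} x (σ : State P r) → link₁ x σ ≤ link₂ x σ
  link₁≤link₂ x (inj₁ _) = ≤-refl
  link₁≤link₂ x (inj₂ π) = x≤x+y _ (nonneg x (Piece.port₂ π))

  edges≤link₁ : ∀ {P r} x (σ : State P r) → cost c (edgesOf σ) ≤ link₁ x σ
  edges≤link₁ x (inj₁ _) = ≤-refl
  edges≤link₁ x (inj₂ π) = x≤x+y _ (nonneg x (Piece.port₁ π))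

  reroot₁ : ∀ {P r} x y (σ : State P r) → link₁ x σ ≤ c x y + link₁ y σ
  reroot₁ x y (inj₁ _) = x≤y+x 0ℚ (nonneg x y)
  reroot₁ x y (inj₂ π) = begin
    f + c x p                ≤⟨ +-monoʳ-≤ f (triangle x y p) ⟩
    f + (c x y + c y p)      ≡⟨ rearrange f (c x y) (c y p) ⟩
    c x y + (f + c y p)      ∎
    where
    open ≤-Reasoning
    f = cost c (Piece.edges π)
    p = Piece.port₁ π
    rearrange : ∀ a b d → a + (b + d) ≡ b + (a + d)
    rearrange = solve-∀ ℚ-ring

  reroot₂ : ∀ {P r} x y (σ : State P r) → link₂ x σ ≤ (c x y + c x y) + link₂ y σ
  reroot₂ x y (inj₁ _) = x≤y+x 0ℚ (+-mono-≤ (nonneg x y) (nonneg x y))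
  reroot₂ x y (inj₂ π) = begin
    f + c x p + c x q                          ≤⟨ +-mono-≤ (+-monoʳ-≤ f (triangle x y p)) (triangle x y q) ⟩
    f + (c x y + c y p) + (c x y + c y q)      ≡⟨ rearrange f (c x y) (c y p) (c y q) ⟩
    (c x y + c x y) + (f + c y p + c y q)      ∎
    where
    open ≤-Reasoning
    f = cost c (Piece.edges π)
    p = Piece.port₁ π
    q = Piece.port₂ π
    rearrange : ∀ a d b e → a + (d + b) + (d + e) ≡ (d + d) + (a + b + e)
    rearrange = solve-∀ ℚ-ring

  record Correspondence (P P′ : Fin n → Set) (r r′ : Fin n) : Set where
    field
      to   : ∀ {v} → P v → P′ v
      from : ∀ {v} → P′ v → P v
      root : P′ r′ → P r × r ≡ r′

  retarget : ∀ {P P′ r r′} → Correspondence P P′ r r′ → State P r → State P′ r′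
  retarget κ (inj₁ absent) = inj₁ (λ p′ → absent (Correspondence.from κ p′))
  retarget κ (inj₂ π) = inj₂ (record
    { nodes = nodes ; edges = edges ; tree = tree
    ; sound = λ v∈ → to (sound v∈) ; complete = λ p′ → complete (from p′)
    ; port₁ = port₁ ; port₂ = port₂ ; port₁∈ = port₁∈ ; port₂∈ = port₂∈
    ; anchored = λ p′ → let (p , r≡r′) = root p′ in
                        trans (proj₁ (anchored p)) r≡r′ , trans (proj₂ (anchored p)) r≡r′ })
    where
    open Piece π
    open Correspondence κ

  retarget-edges : ∀ {P P′ r r′} (κ : Correspondence P P′ r r′) σ → edgesOf (retarget κ σ) ≡ edgesOf σ
  retarget-edges κ (inj₁ _) = refl
  retarget-edges κ (inj₂ _) = refl

  retarget-link₂ : ∀ {P P′ r r′} (κ : Correspondence P P′ r r′) x σ → link₂ x (retarget κ σ) ≡ link₂ x σ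
  retarget-link₂ κ x (inj₁ _) = refl
  retarget-link₂ κ x (inj₂ _) = refl

  retarget-link₁ : ∀ {P P′ r r′} (κ : Correspondence P P′ r r′) x σ → link₁ x (retarget κ σ) ≡ link₁ x σ
  retarget-link₁ κ x (inj₁ _) = refl
  retarget-link₁ κ x (inj₂ _) = refl

  state-spans : ∀ {P r} {X : Subset n} (σ : State P r) → (∀ {v} → P v → v ∈ X) → (∀ {v} → v ∈ X → P v) →
                SpanningTree X (edgesOf σ)
  state-spans {X = X} (inj₁ absent) _ fromX = subst (λ S → SpanningTree S []) ⊥≡X tree-empty
    where
    ⊥≡X : ⊥ ≡ X
    ⊥≡X = ⊆-antisym (λ v∈⊥ → ⊥-elim (∉⊥ v∈⊥)) (λ v∈X → ⊥-elim (absent (fromX v∈X)))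
  state-spans {X = X} (inj₂ π) toX fromX = subst (λ S → SpanningTree S (Piece.edges π)) nodes≡X (Piece.tree π)
    where
    nodes≡X : Piece.nodes π ≡ X
    nodes≡X = ⊆-antisym (λ v∈ → toX (Piece.sound π v∈)) (λ v∈X → Piece.complete π (fromX v∈X))

  bridge-cost : ∀ {a b} (a≢b : a ≢ b) F G → cost c (edgeBetween a b a≢b ∷ F ++ G) ≡ c a b + (cost c F + cost c G)
  bridge-cost {a} {b} a≢b F G = cong₂ _+_ (weight-joins {e = edgeBetween a b a≢b} (edgeBetween-joins a b a≢b)) (cost-++ F G)

  -- Merging pays for triangles over the edge {u,y}: once for a colour that
  -- contains the root u, twice for the others.
  charge : ∀ {A : Set} → ℚ → Dec A → ℚ
  charge δ (yes _) = δ
  charge δ (no _) = δ + δ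

  charge-nonneg : ∀ {A : Set} {δ} (d : Dec A) → 0ℚ ≤ δ → 0ℚ ≤ charge δ d
  charge-nonneg (yes _) 0≤δ = 0≤δ
  charge-nonneg (no _) 0≤δ = +-mono-≤ 0≤δ 0≤δ

  charge≤ : ∀ {A : Set} {δ} (d : Dec A) → 0ℚ ≤ δ → charge δ d ≤ δ + δ
  charge≤ (yes _) 0≤δ = x≤x+y _ 0≤δ
  charge≤ (no _) _ = ≤-refl

  charge-pair : ∀ {A B : Set} {δ} (dA : Dec A) (dB : Dec B) → A ⊎ B → 0ℚ ≤ δ → charge δ dA + charge δ dB ≤ δ + δ + δ
  charge-pair (yes _) (yes _) _ 0≤δ = x≤x+y _ 0≤δ
  charge-pair {δ = δ} (yes _) (no _) _ _ = ≤-reflexive (sym (+-assoc δ δ δ))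
  charge-pair (no _) (yes _) _ _ = ≤-refl
  charge-pair (no ¬a) (no _) (inj₁ a) _ = ⊥-elim (¬a a)
  charge-pair (no _) (no ¬b) (inj₂ b) _ = ⊥-elim (¬b b)

  module Merge {PA PB : Fin n → Set} (disjoint : ∀ {v} → PA v → PB v → Void)
               (u y : Fin n) (notB : ¬ PB u) where

    Target : Fin n → Set
    Target v = PA v ⊎ PB v

    δ : ℚ
    δ = c u y

    apart : (A : Piece PA u) (B : Piece PB y) → ∀ {a b} → a ∈ Piece.nodes A → b ∈ Piece.nodes B → a ≢ b
    apart A B a∈ b∈ refl = disjoint (Piece.sound A a∈) (Piece.sound B b∈)

    glue : (A : Piece PA u) (B : Piece PB y) → ∀ {a b} (a∈ : a ∈ Piece.nodes A) (b∈ : b ∈ Piece.nodes B) →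
           ∀ p q → p ∈ Piece.nodes A ∪ Piece.nodes B → q ∈ Piece.nodes A ∪ Piece.nodes B →
           (Target u → p ≡ u × q ≡ u) → Piece Target u
    glue A B a∈ b∈ p q p∈ q∈ anchor = record
      { nodes = A.nodes ∪ B.nodes
      ; edges = edgeBetween _ _ (apart A B a∈ b∈) ∷ A.edges ++ B.edges
      ; tree = tree-join A.tree B.tree (λ x x∈A x∈B → disjoint (A.sound x∈A) (B.sound x∈B)) a∈ b∈ (apart A B a∈ b∈)
      ; sound = λ v∈ → [ (λ h → inj₁ (A.sound h)) , (λ h → inj₂ (B.sound h)) ] (x∈p∪q⁻ A.nodes B.nodes v∈)
      ; complete = λ { (inj₁ h) → x∈p∪q⁺ (inj₁ (A.complete h)) ; (inj₂ h) → x∈p∪q⁺ (inj₂ (B.complete h)) }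
      ; port₁ = p ; port₂ = q ; port₁∈ = p∈ ; port₂∈ = q∈ ; anchored = anchor }
      where
      module A = Piece A
      module B = Piece B

    noTarget : ¬ PA u → ¬ Target u
    noTarget ¬pa (inj₁ pa) = ¬pa pa
    noTarget ¬pa (inj₂ pb) = notB pb

    -- Join the first ports of A and B; both new ports are the first port of
    -- A, which is u whenever u is a target.
    joinPorts : (A : Piece PA u) (B : Piece PB y) → Piece Target u
    joinPorts A B = glue A B A.port₁∈ B.port₁∈ A.port₁ A.port₁ (x∈p∪q⁺ (inj₁ A.port₁∈)) (x∈p∪q⁺ (inj₁ A.port₁∈)) anchor
      where
      module A = Piece A
      module B = Piece B
      anchor : Target u → A.port₁ ≡ u × A.port₁ ≡ u
      anchor (inj₁ pa) = proj₁ (A.anchored pa) , proj₁ (A.anchored pa)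
      anchor (inj₂ pb) = ⊥-elim (notB pb)

    joinPorts-cost : ∀ A B → cost c (Piece.edges (joinPorts A B)) ≤ δ + (link₁ u (inj₂ A) + link₁ y (inj₂ B))
    joinPorts-cost A B = begin
      cost c (e₀ ∷ A.edges ++ B.edges)  ≡⟨ bridge-cost (apart A B A.port₁∈ B.port₁∈) A.edges B.edges ⟩
      c A.port₁ B.port₁ + (f + g)       ≤⟨ +-monoˡ-≤ (f + g) (via u y A.port₁ B.port₁) ⟩
      (pa + (δ + pb)) + (f + g)         ≡⟨ rearrange pa δ pb f g ⟩
      δ + ((f + pa) + (g + pb))         ∎
      where
      open ≤-Reasoning
      module A = Piece A
      module B = Piece B
      e₀ = edgeBetween A.port₁ B.port₁ (apart A B A.port₁∈ B.port₁∈)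
      f = cost c A.edges
      g = cost c B.edges
      pa = c u A.port₁
      pb = c y B.port₁
      rearrange : ∀ pa d pb f g → (pa + (d + pb)) + (f + g) ≡ d + ((f + pa) + (g + pb))
      rearrange = solve-∀ ℚ-ring

    -- If u is a target, both ports of the joined piece are u and cost nothing.
    joinAtRoot : (A : Piece PA u) (B : Piece PB y) → PA u →
                 link₂ u (inj₂ (joinPorts A B)) ≤ δ + (link₁ u (inj₂ A) + link₁ y (inj₂ B))
    joinAtRoot A B pa = begin
      t + z + z     ≡⟨ cong (λ r → t + r + r) z≡0 ⟩
      t + 0ℚ + 0ℚ   ≡⟨ trans (+-identityʳ (t + 0ℚ)) (+-identityʳ t) ⟩
      t             ≤⟨ joinPorts-cost A B ⟩
      δ + (link₁ u (inj₂ A) + link₁ y (inj₂ B)) ∎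
      where
      open ≤-Reasoning
      t = cost c (Piece.edges (joinPorts A B))
      z = c u (Piece.port₁ A)
      z≡0 : z ≡ 0ℚ
      z≡0 = trans (cong (c u) (proj₁ (Piece.anchored A pa))) (diag u)

    joinThrough : (A : Piece PA u) (B : Piece PB y) → ¬ PA u →
                  Σ (Piece Target u) λ π → (link₂ u (inj₂ π) ≤ (δ + δ) + (link₂ u (inj₂ A) + link₂ y (inj₂ B)))
                                         × (link₁ u (inj₂ π) ≤ δ + (link₂ u (inj₂ A) + link₁ y (inj₂ B)))
    joinThrough A B ¬pa = π , linked₂ , linked₁
      where
      open ≤-Reasoning
      module A = Piece A
      module B = Piece B
      π = glue A B A.port₂∈ B.port₁∈ A.port₁ B.port₂ (x∈p∪q⁺ (inj₁ A.port₁∈)) (x∈p∪q⁺ (inj₂ B.port₂∈))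
                (λ t → ⊥-elim (noTarget ¬pa t))
      f = cost c A.edges
      g = cost c B.edges
      pa = c u A.port₁
      qa = c u A.port₂
      pb = c y B.port₁
      qb = c y B.port₂
      e₀ = edgeBetween A.port₂ B.port₁ (apart A B A.port₂∈ B.port₁∈)
      bridge : cost c (e₀ ∷ A.edges ++ B.edges) ≤ qa + (δ + pb) + (f + g)
      bridge = begin
        cost c (e₀ ∷ A.edges ++ B.edges)                ≡⟨ bridge-cost (apart A B A.port₂∈ B.port₁∈) A.edges B.edges ⟩
        c A.port₂ B.port₁ + (f + g)                     ≤⟨ +-monoˡ-≤ (f + g) (via u y A.port₂ B.port₁) ⟩
        qa + (δ + pb) + (f + g)                         ∎
      rearrange₂ : ∀ qa d pb f g pa qb → (qa + (d + pb) + (f + g)) + pa + (d + qb) ≡ (d + d) + ((f + pa + qa) + (g + pb + qb))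
      rearrange₂ = solve-∀ ℚ-ring
      rearrange₁ : ∀ qa d pb f g pa → (qa + (d + pb) + (f + g)) + pa ≡ d + ((f + pa + qa) + (g + pb))
      rearrange₁ = solve-∀ ℚ-ring
      linked₂ : link₂ u (inj₂ π) ≤ (δ + δ) + (link₂ u (inj₂ A) + link₂ y (inj₂ B))
      linked₂ = begin
        cost c (e₀ ∷ A.edges ++ B.edges) + pa + c u B.port₂ ≤⟨ +-mono-≤ (+-monoˡ-≤ pa bridge) (triangle u y B.port₂) ⟩
        (qa + (δ + pb) + (f + g)) + pa + (δ + qb) ≡⟨ rearrange₂ qa δ pb f g pa qb ⟩
        (δ + δ) + ((f + pa + qa) + (g + pb + qb)) ∎
      linked₁ : link₁ u (inj₂ π) ≤ δ + (link₂ u (inj₂ A) + link₁ y (inj₂ B))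
      linked₁ = begin
        cost c (e₀ ∷ A.edges ++ B.edges) + pa  ≤⟨ +-monoˡ-≤ pa bridge ⟩
        (qa + (δ + pb) + (f + g)) + pa      ≡⟨ rearrange₁ qa δ pb f g pa ⟩
        δ + ((f + pa + qa) + (g + pb))      ∎

    joinAcross : (A : Piece PA u) (B : Piece PB y) → ¬ PA u →
                 Σ (Piece Target u) λ π → link₁ u (inj₂ π) ≤ (δ + δ) + (link₁ u (inj₂ A) + link₂ y (inj₂ B))
    joinAcross A B ¬pa = π , (begin
      cost c (e₀ ∷ A.edges ++ B.edges) + c u B.port₂
                  ≡⟨ cong (_+ c u B.port₂) (bridge-cost (apart A B A.port₁∈ B.port₁∈) A.edges B.edges) ⟩
      (c A.port₁ B.port₁ + (f + g)) + c u B.port₂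
                  ≤⟨ +-mono-≤ (+-monoˡ-≤ (f + g) (via u y A.port₁ B.port₁)) (triangle u y B.port₂) ⟩
      (pa + (δ + pb) + (f + g)) + (δ + qb)
                  ≡⟨ rearrange pa δ pb f g qb ⟩
      (δ + δ) + ((f + pa) + (g + pb + qb)) ∎)
      where
      open ≤-Reasoning
      module A = Piece A
      module B = Piece B
      π = glue A B A.port₁∈ B.port₁∈ B.port₂ A.port₁ (x∈p∪q⁺ (inj₂ B.port₂∈)) (x∈p∪q⁺ (inj₁ A.port₁∈))
                (λ t → ⊥-elim (noTarget ¬pa t))
      f = cost c A.edges
      g = cost c B.edges
      e₀ = edgeBetween A.port₁ B.port₁ (apart A B A.port₁∈ B.port₁∈)
      pa = c u A.port₁
      pb = c y B.port₁
      qb = c y B.port₂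
      rearrange : ∀ pa d pb f g qb → (pa + (d + pb) + (f + g)) + (d + qb) ≡ (d + d) + ((f + pa) + (g + pb + qb))
      rearrange = solve-∀ ℚ-ring

    sideA : Absent PB → Correspondence PA Target u u
    sideA noB = record { to = inj₁ ; from = λ { (inj₁ a) → a ; (inj₂ b) → ⊥-elim (noB b) }
                       ; root = λ { (inj₁ a) → a , refl ; (inj₂ b) → ⊥-elim (notB b) } }

    sideB : Absent PA → Correspondence PB Target y u
    sideB noA = record { to = inj₂ ; from = λ { (inj₁ a) → ⊥-elim (noA a) ; (inj₂ b) → b }
                       ; root = λ t → ⊥-elim (noTarget noA t) }

    onlyA : Absent PB → State PA u → State Target u
    onlyA noB = retarget (sideA noB)

    onlyB : Absent PA → State PB y → State Target u
    onlyB noA = retarget (sideB noA)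

    merge₁ : (root? : Dec (PA u)) (σA : State PA u) (σB : State PB y) → Σ (State Target u) λ σ →
             (link₂ u σ ≤ charge δ root? + (link₂ u σA + link₂ y σB))
             × (link₁ u σ ≤ δ + (link₂ u σA + link₁ y σB))
    merge₁ (yes pa) (inj₁ noA) _ = ⊥-elim (noA pa)
    merge₁ (no _) (inj₁ noA) σB = onlyB noA σB ,
      (begin
        link₂ u (onlyB noA σB)          ≡⟨ retarget-link₂ (sideB noA) u σB ⟩
        link₂ u σB                      ≤⟨ reroot₂ u y σB ⟩
        (δ + δ) + link₂ y σB            ≡⟨ cong ((δ + δ) +_) (sym (+-identityˡ _)) ⟩
        (δ + δ) + (0ℚ + link₂ y σB)     ∎) ,
      (begin
        link₁ u (onlyB noA σB)          ≡⟨ retarget-link₁ (sideB noA) u σB ⟩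
        link₁ u σB                      ≤⟨ reroot₁ u y σB ⟩
        δ + link₁ y σB                  ≡⟨ cong (δ +_) (sym (+-identityˡ _)) ⟩
        δ + (0ℚ + link₁ y σB)           ∎)
      where open ≤-Reasoning
    merge₁ root? (inj₂ A) (inj₁ noB) = onlyA noB (inj₂ A) ,
      ≤-pad (charge-nonneg root? (nonneg u y)) ≤-refl ,
      ≤-pad (nonneg u y) (link₁≤link₂ u (inj₂ A))
    merge₁ (yes pa) (inj₂ A) (inj₂ B) = inj₂ π ,
      ≤-trans bound (+-monoʳ-≤ δ (+-mono-≤ JA≤KA JB≤KB)) ,
      ≤-trans (link₁≤link₂ u (inj₂ π)) (≤-trans bound (+-monoʳ-≤ δ (+-monoˡ-≤ (link₁ y (inj₂ B)) JA≤KA)))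
      where
      π = joinPorts A B
      bound : link₂ u (inj₂ π) ≤ δ + (link₁ u (inj₂ A) + link₁ y (inj₂ B))
      bound = joinAtRoot A B pa
      JA≤KA : link₁ u (inj₂ A) ≤ link₂ u (inj₂ A)
      JA≤KA = link₁≤link₂ u (inj₂ A)
      JB≤KB : link₁ y (inj₂ B) ≤ link₂ y (inj₂ B)
      JB≤KB = link₁≤link₂ y (inj₂ B)
    merge₁ (no ¬pa) (inj₂ A) (inj₂ B) = inj₂ (proj₁ (joinThrough A B ¬pa)) , proj₂ (joinThrough A B ¬pa)

    merge₂ : (root? : Dec (PA u)) (σA : State PA u) (σB : State PB y) → Σ (State Target u) λ σ →
             link₁ u σ ≤ charge δ root? + (link₁ u σA + link₂ y σB)
    merge₂ (yes pa) (inj₁ noA) _ = ⊥-elim (noA pa)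
    merge₂ (no _) (inj₁ noA) σB = onlyB noA σB , (begin
      link₁ u (onlyB noA σB)          ≡⟨ retarget-link₁ (sideB noA) u σB ⟩
      link₁ u σB                      ≤⟨ reroot₁ u y σB ⟩
      δ + link₁ y σB                  ≤⟨ +-mono-≤ (x≤x+y δ (nonneg u y)) (link₁≤link₂ y σB) ⟩
      (δ + δ) + link₂ y σB            ≡⟨ cong ((δ + δ) +_) (sym (+-identityˡ _)) ⟩
      (δ + δ) + (0ℚ + link₂ y σB)     ∎)
      where open ≤-Reasoning
    merge₂ root? (inj₂ A) (inj₁ noB) = onlyA noB (inj₂ A) , ≤-pad (charge-nonneg root? (nonneg u y)) ≤-refl
    merge₂ (yes pa) (inj₂ A) (inj₂ B) = inj₂ π ,
      ≤-trans (link₁≤link₂ u (inj₂ π)) (≤-trans bound (+-monoʳ-≤ δ (+-monoʳ-≤ (link₁ u (inj₂ A)) JB≤KB)))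
      where
      π = joinPorts A B
      bound : link₂ u (inj₂ π) ≤ δ + (link₁ u (inj₂ A) + link₁ y (inj₂ B))
      bound = joinAtRoot A B pa
      JB≤KB : link₁ y (inj₂ B) ≤ link₂ y (inj₂ B)
      JB≤KB = link₁≤link₂ y (inj₂ B)
    merge₂ (no ¬pa) (inj₂ A) (inj₂ B) = inj₂ (proj₁ (joinAcross A B ¬pa)) , proj₂ (joinAcross A B ¬pa)

    merge₀ : (σA : State PA u) (σB : State PB y) → Σ (State Target u) λ σ →
             (cost c (edgesOf σ) ≤ δ + (link₁ u σA + link₁ y σB))
             × (Absent PA → cost c (edgesOf σ) ≤ link₁ y σB)
    merge₀ (inj₁ noA) σB = onlyB noA σB ,
      ≤-trans onB (≤-trans (x≤y+x _ (nonneg u y)) (+-monoʳ-≤ δ (≤-reflexive (sym (+-identityˡ _))))) ,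
      λ _ → onB
      where
      onB : cost c (edgesOf (onlyB noA σB)) ≤ link₁ y σB
      onB = ≤-trans (≤-reflexive (cong (cost c) (retarget-edges (sideB noA) σB))) (edges≤link₁ y σB)
    merge₀ (inj₂ A) (inj₁ noB) = onlyA noB (inj₂ A) ,
      ≤-pad (nonneg u y) (edges≤link₁ u (inj₂ A)) ,
      λ noA → ⊥-elim (noA (Piece.sound A (Piece.port₁∈ A)))
    merge₀ (inj₂ A) (inj₂ B) = inj₂ (joinPorts A B) , joinPorts-cost A B ,
      λ noA → ⊥-elim (noA (Piece.sound A (Piece.port₁∈ A)))

  Colour : List (Edge n) → Fin n → Subset n → Fin n → Set
  Colour F u X v = v ∈ X × Reach F u v

  Part : List (Edge n) → Fin n → Subset n → Set
  Part F u X = State (Colour F u X) u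

  Covers : Subset n → Subset n → Set
  Covers X Y = ∀ v → v ∈ X ⊎ v ∈ Y

  record Bounds (F : List (Edge n)) (u : Fin n) : Set where
    field
      pairK : ∀ X Y → Covers X Y → Σ (Part F u X) λ σ → Σ (Part F u Y) λ τ →
              link₂ u σ + link₂ u τ ≤ 3ℚ * cost c F
      pairJ : ∀ X Y → Covers X Y → (g : OptEdge F) → Σ (Part F u X) λ σ → Σ (Part F u Y) λ τ →
              link₁ u σ + link₁ u τ + wt g ≤ 3ℚ * cost c F
      soloK : ∀ X → Σ (Part F u X) λ σ → link₂ u σ ≤ 2ℚ * cost c F
      soloJ : ∀ X (g : OptEdge F) → Σ (Part F u X) λ σ → link₁ u σ + wt g ≤ 2ℚ * cost c F

  wt≤cost : ∀ {F} (g : OptEdge F) → wt g ≤ cost c F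
  wt≤cost {F} none = cost-nonneg F
  wt≤cost (some g g∈) = weight≤cost g∈

  module Relabel {F G : List (Edge n)} {u : Fin n}
                 (to : ∀ {v} → Reach F u v → Reach G u v) (from : ∀ {v} → Reach G u v → Reach F u v) where

    relabelling : ∀ {X} → Correspondence (Colour F u X) (Colour G u X) u u
    relabelling = record { to = λ (x∈ , r) → x∈ , to r ; from = λ (x∈ , r) → x∈ , from r
                         ; root = λ (x∈ , r) → (x∈ , from r) , refl }

    relabel : ∀ {X} → Part F u X → Part G u X
    relabel = retarget relabelling

    relabel-link₂ : ∀ {X} (σ : Part F u X) → link₂ u (relabel σ) ≡ link₂ u σ
    relabel-link₂ = retarget-link₂ relabelling u

    relabel-link₁ : ∀ {X} (σ : Part F u X) → link₁ u (relabel σ) ≡ link₁ u σ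
    relabel-link₁ = retarget-link₁ relabelling u

  -- Base case: no edge of F touches u, so the only candidate target is u.
  module Isolated {F : List (Edge n)} {u : Fin n} (untouched : ∀ g → g ∈ₗ F → ¬ EndOf g u) where

    part : ∀ X → Part F u X
    part X with u ∈? X
    ... | yes u∈X = inj₂ (record
      { nodes = ⁅ u ⁆ ; edges = [] ; tree = tree-single u
      ; sound = λ v∈ → let u≡v = sym (x∈⁅y⁆⇒x≡y u v∈) in subst (_∈ X) u≡v u∈X , subst (Reach F u) u≡v here
      ; complete = λ (_ , r) → subst (_∈ ⁅ u ⁆) (walk-isolated untouched r) (x∈⁅x⁆ u)
      ; port₁ = u ; port₂ = u ; port₁∈ = x∈⁅x⁆ u ; port₂∈ = x∈⁅x⁆ u ; anchored = λ _ → refl , refl })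
    ... | no u∉X = inj₁ (λ (v∈X , r) → u∉X (subst (_∈ X) (sym (walk-isolated untouched r)) v∈X))

    free₂ : ∀ X → link₂ u (part X) ≤ 0ℚ
    free₂ X with u ∈? X
    ... | yes _ rewrite diag u = ≤-refl
    ... | no _ = ≤-refl

    free₁ : ∀ X → link₁ u (part X) ≤ 0ℚ
    free₁ X = ≤-trans (link₁≤link₂ u (part X)) (free₂ X)

    fits : ∀ m {x t} → x ≤ 0ℚ → t ≤ cost c F → cost c F ≤ m * cost c F → x + t ≤ m * cost c F
    fits m {x} {t} hx ht hm = ≤-trans (+-mono-≤ hx ht) (≤-trans (≤-reflexive (+-identityˡ (cost c F))) hm)

    bounds : Bounds F u
    bounds = record
      { pairK = λ X Y _ → part X , part Y , ≤-trans (+-mono-≤ (free₂ X) (free₂ Y)) (≤-trans c≥0 (≤-triple c≥0))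
      ; pairJ = λ X Y _ g → part X , part Y , fits 3ℚ (+-mono-≤ (free₁ X) (free₁ Y)) (wt≤cost g) (≤-triple c≥0)
      ; soloK = λ X → part X , ≤-trans (free₂ X) (≤-trans c≥0 (≤-double c≥0))
      ; soloJ = λ X g → part X , fits 2ℚ (free₁ X) (wt≤cost g) (≤-double c≥0) }
      where
      c≥0 : 0ℚ ≤ cost c F
      c≥0 = cost-nonneg F

  bounds-↭ : ∀ {F G u} → F ↭ G → Bounds G u → Bounds F u
  bounds-↭ {F} {G} {u} F↭G IH = record
    { pairK = λ X Y cov → let (σ , τ , h) = IH.pairK X Y cov in
        relabel σ , relabel τ , within 3ℚ (cong₂ _+_ (relabel-link₂ σ) (relabel-link₂ τ)) h
    ; pairJ = λ X Y cov g → let (σ , τ , h) = IH.pairJ X Y cov (toG g) in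
        relabel σ , relabel τ , within 3ℚ (cong₂ _+_ (cong₂ _+_ (relabel-link₁ σ) (relabel-link₁ τ)) (wt-toG g)) h
    ; soloK = λ X → let (σ , h) = IH.soloK X in relabel σ , within 2ℚ (relabel-link₂ σ) h
    ; soloJ = λ X g → let (σ , h) = IH.soloJ X (toG g) in
        relabel σ , within 2ℚ (cong₂ _+_ (relabel-link₁ σ) (wt-toG g)) h }
    where
    module IH = Bounds IH
    open Relabel (walk-mono (∈-resp-↭ (↭-sym F↭G))) (walk-mono (∈-resp-↭ F↭G))
    toG : OptEdge F → OptEdge G
    toG none = none
    toG (some g g∈) = some g (∈-resp-↭ F↭G g∈)
    wt-toG : ∀ g → wt g ≡ wt (toG g)
    wt-toG none = refl
    wt-toG (some _ _) = refl
    within : ∀ m {x x′} → x ≡ x′ → x′ ≤ m * cost c G → x ≤ m * cost c F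
    within m x≡x′ h = subst₂ _≤_ (sym x≡x′) (cong (m *_) (sym (cost-↭ F↭G))) h

  module Step {F : List (Edge n)} {e : Edge n} {u y : Fin n} (joins : Joins e u y) where

    δ : ℚ
    δ = c u y

    cost-step : cost c (e ∷ F) ≡ δ + cost c F
    cost-step = cong (_+ cost c F) (weight-joins {e = e} joins)

    end₁-near : end₁ e ≡ u ⊎ end₁ e ≡ y
    end₁-near = [ (λ (p , _) → inj₁ p) , (λ (p , _) → inj₂ p) ] joins

    end₂-near : end₂ e ≡ u ⊎ end₂ e ≡ y
    end₂-near = [ (λ (_ , q) → inj₂ q) , (λ (_ , q) → inj₁ q) ] joins

    from-end : ∀ {a v} → (a ≡ u ⊎ a ≡ y) → Reach F a v → Reach F u v ⊎ Reach F y v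
    from-end (inj₁ a≡u) r = inj₁ (subst (λ a → Reach F a _) a≡u r)
    from-end (inj₂ a≡y) r = inj₂ (subst (λ a → Reach F a _) a≡y r)

    restart : ∀ {v} → Reach (e ∷ F) u v → Reach F u v ⊎ Reach F y v
    restart r with walk-via r
    ... | inj₁ r′ = inj₁ r′
    ... | inj₂ (_ , inj₁ r′) = from-end end₁-near r′
    ... | inj₂ (_ , inj₂ r′) = from-end end₂-near r′

    to-y : ∀ {v} → Reach F y v → Reach (e ∷ F) u v
    to-y r = step e (here refl) joins (walk-mono there r)

    -- Cycle case: u and y remain connected without e.
    module Cycle (u~y : Reach F u y) (IH : Bounds F u) where
      open Relabel {F} {e ∷ F} {u} (walk-mono there) (λ r → [ (λ r′ → r′) , walk-++ u~y ] (restart r))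
      module IH = Bounds IH

      drop-e : (g : OptEdge (e ∷ F)) → Σ (OptEdge F) λ g′ → wt g ≤ wt g′ + δ
      drop-e none = none , ≤-trans (nonneg u y) (≤-reflexive (sym (+-identityˡ δ)))
      drop-e (some g (here refl)) = none , ≤-reflexive (trans (weight-joins {e = e} joins) (sym (+-identityˡ δ)))
      drop-e (some g (there g∈)) = some g g∈ , x≤x+y (w c g) (nonneg u y)

      within : ∀ m {x x′} → x ≡ x′ → x′ ≤ m * (δ + cost c F) → x ≤ m * cost c (e ∷ F)
      within m x≡x′ h = subst₂ _≤_ (sym x≡x′) (cong (m *_) (sym cost-step)) h

      bounds : Bounds (e ∷ F) u
      bounds = record
        { pairK = λ X Y cov → let (σ , τ , h) = IH.pairK X Y cov in
            relabel σ , relabel τ ,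
            within 3ℚ (cong₂ _+_ (relabel-link₂ σ) (relabel-link₂ τ))
                   (grow-budget 3ℚ {C = cost c F} {d = δ} (≤-trans δ≥0 (≤-triple δ≥0)) h)
        ; pairJ = λ X Y cov g → let (g′ , hg) = drop-e g ; (σ , τ , h) = IH.pairJ X Y cov g′ in
            relabel σ , relabel τ ,
            within 3ℚ (cong (_+ wt g) (cong₂ _+_ (relabel-link₁ σ) (relabel-link₁ τ)))
                   (grow-budget′ 3ℚ {link₁ u σ + link₁ u τ} {wt g} {wt g′} {cost c F} {δ} (≤-triple δ≥0) h hg)
        ; soloK = λ X → let (σ , h) = IH.soloK X in
            relabel σ ,
            within 2ℚ (relabel-link₂ σ) (grow-budget 2ℚ {C = cost c F} {d = δ} (≤-trans δ≥0 (≤-double δ≥0)) h)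
        ; soloJ = λ X g → let (g′ , hg) = drop-e g ; (σ , h) = IH.soloJ X g′ in
            relabel σ ,
            within 2ℚ (cong (_+ wt g) (relabel-link₁ σ))
                   (grow-budget′ 2ℚ {link₁ u σ} {wt g} {wt g′} {cost c F} {δ} (≤-double δ≥0) h hg) }
        where
        δ≥0 : 0ℚ ≤ δ
        δ≥0 = nonneg u y

    -- Bridge case: removing e separates u from y.  The edges of F split into
    -- FA, those whose first end is reachable from u, and the rest FB.
    module Bridge (u≁y : ¬ Reach F u y) where

      near? : ∀ g → Dec (Reach F u (end₁ g))
      near? g = reachable? F u (end₁ g)

      FA FB : List (Edge n)
      FA = filter near? F
      FB = filter (λ g → ¬? (near? g)) F

      cost-split : cost c (e ∷ F) ≡ δ + (cost c FA + cost c FB)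
      cost-split = trans cost-step (cong (δ +_) (cost-filter near? F))

      FA⊆F : ∀ {g} → g ∈ₗ FA → g ∈ₗ F
      FA⊆F g∈ = proj₁ (∈-filter⁻ near? g∈)

      FB⊆F : ∀ {g} → g ∈ₗ FB → g ∈ₗ F
      FB⊆F g∈ = proj₁ (∈-filter⁻ (λ g → ¬? (near? g)) g∈)

      confineA : ∀ {v} → Reach F u v → Reach FA u v
      confineA = walk-confine (λ g∈ r → ∈-filter⁺ near? g∈ r)

      confineB : ∀ {v} → Reach F y v → Reach FB y v
      confineB = walk-confine (λ g∈ r → ∈-filter⁺ (λ g → ¬? (near? g)) g∈ (λ r′ → u≁y (walk-++ r′ (walk-sym r))))

      apart : ∀ {v} → Reach FA u v → Reach FB y v → Void
      apart ra rb = u≁y (walk-++ (walk-mono FA⊆F ra) (walk-sym (walk-mono FB⊆F rb)))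

      sides : ∀ {v} → Reach (e ∷ F) u v → Reach FA u v ⊎ Reach FB y v
      sides r = [ (λ r′ → inj₁ (confineA r′)) , (λ r′ → inj₂ (confineB r′)) ] (restart r)

      unsides : ∀ {v} → Reach FA u v ⊎ Reach FB y v → Reach (e ∷ F) u v
      unsides (inj₁ ra) = walk-mono (λ g∈ → there (FA⊆F g∈)) ra
      unsides (inj₂ rb) = to-y (walk-mono FB⊆F rb)

      module M (X : Subset n) =
        Merge {Colour FA u X} {Colour FB y X} (λ (_ , ra) (_ , rb) → apart ra rb) u y (λ (_ , rb) → apart here rb)

      root? : ∀ X → Dec (Colour FA u X u)
      root? X = map′ (λ u∈ → u∈ , here) proj₁ (u ∈? X)

      charges : ∀ {X Y} → Covers X Y → charge δ (root? X) + charge δ (root? Y) ≤ 3ℚ * δ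
      charges {X} {Y} cov = ≤-trans (charge-pair (root? X) (root? Y) roots (nonneg u y)) (≤-reflexive (sym (three δ)))
        where
        roots : Colour FA u X u ⊎ Colour FA u Y u
        roots = [ (λ u∈ → inj₁ (u∈ , here)) , (λ u∈ → inj₂ (u∈ , here)) ] (cov u)

      joined : ∀ {X} → Correspondence (M.Target X) (Colour (e ∷ F) u X) u u
      joined = record
        { to = λ { (inj₁ (x∈ , r)) → x∈ , unsides (inj₁ r) ; (inj₂ (x∈ , r)) → x∈ , unsides (inj₂ r) }
        ; from = λ (x∈ , r) → [ (λ ra → inj₁ (x∈ , ra)) , (λ rb → inj₂ (x∈ , rb)) ] (sides r)
        ; root = λ (x∈ , _) → inj₁ (x∈ , here) , refl }

      out : ∀ {X} → State (M.Target X) u → Part (e ∷ F) u X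
      out = retarget joined

      out-link₂ : ∀ {X} (σ : State (M.Target X) u) → link₂ u (out σ) ≡ link₂ u σ
      out-link₂ = retarget-link₂ joined u

      out-link₁ : ∀ {X} (σ : State (M.Target X) u) → link₁ u (out σ) ≡ link₁ u σ
      out-link₁ = retarget-link₁ joined u

      classify : (g : OptEdge (e ∷ F)) → (Σ (OptEdge FB) λ g′ → wt g ≤ wt g′ + δ) ⊎ (Σ (OptEdge FA) λ g′ → wt g ≡ wt g′)
      classify none = inj₁ (none , ≤-trans (nonneg u y) (≤-reflexive (sym (+-identityˡ δ))))
      classify (some g (here refl)) = inj₁ (none , ≤-reflexive (trans (weight-joins {e = e} joins) (sym (+-identityˡ δ))))
      classify (some g (there g∈)) with near? g
      ... | yes p = inj₂ (some g (∈-filter⁺ near? g∈ p) , refl)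
      ... | no ¬p = inj₁ (some g (∈-filter⁺ (λ g → ¬? (near? g)) g∈ ¬p) , x≤x+y (w c g) (nonneg u y))

      within : ∀ m {x x′} → x ≡ x′ → x′ ≤ m * (δ + (cost c FA + cost c FB)) → x ≤ m * cost c (e ∷ F)
      within m x≡x′ h = subst₂ _≤_ (sym x≡x′) (cong (m *_) (sym cost-split)) h

      bounds : Bounds FA u → Bounds FB y → Bounds (e ∷ F) u
      bounds IHA IHB = record { pairK = pairK ; pairJ = pairJ ; soloK = soloK ; soloJ = soloJ }
        where
        module A = Bounds IHA
        module B = Bounds IHB
        open ≤-Reasoning
        cA = cost c FA
        cB = cost c FB

        charge≤2δ : ∀ X → charge δ (root? X) ≤ 2ℚ * δ
        charge≤2δ X = ≤-trans (charge≤ (root? X) (nonneg u y)) (≤-reflexive (sym (two δ)))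

        pairK : ∀ X Y → Covers X Y → Σ (Part (e ∷ F) u X) λ σ → Σ (Part (e ∷ F) u Y) λ τ →
                link₂ u σ + link₂ u τ ≤ 3ℚ * cost c (e ∷ F)
        pairK X Y cov with A.pairK X Y cov | B.pairK X Y cov
        ... | a₀ , a₁ , hA | b₀ , b₁ , hB with M.merge₁ X (root? X) a₀ b₀ | M.merge₁ Y (root? Y) a₁ b₁
        ...   | σ , kσ , _ | τ , kτ , _ = out σ , out τ , within 3ℚ (cong₂ _+_ (out-link₂ σ) (out-link₂ τ)) (begin
          link₂ u σ + link₂ u τ                    ≤⟨ +-mono-≤ kσ kτ ⟩
          (dX + (A₀ + B₀)) + (dY + (A₁ + B₁))      ≡⟨ pair-sum dX A₀ B₀ dY A₁ B₁ ⟩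
          (dX + dY) + ((A₀ + A₁) + (B₀ + B₁))      ≤⟨ budget 3ℚ {δ} {cA} {cB} (charges cov) hA hB ⟩
          3ℚ * (δ + (cA + cB))                     ∎)
          where
          dX = charge δ (root? X)
          dY = charge δ (root? Y)
          A₀ = link₂ u a₀
          A₁ = link₂ u a₁
          B₀ = link₂ y b₀
          B₁ = link₂ y b₁

        pairJ : ∀ X Y → Covers X Y → (g : OptEdge (e ∷ F)) → Σ (Part (e ∷ F) u X) λ σ → Σ (Part (e ∷ F) u Y) λ τ →
                link₁ u σ + link₁ u τ + wt g ≤ 3ℚ * cost c (e ∷ F)
        pairJ X Y cov g with classify g
        ... | inj₁ (g′ , hg) with A.pairK X Y cov | B.pairJ X Y cov g′
        ...   | a₀ , a₁ , hA | b₀ , b₁ , hB with M.merge₁ X (root? X) a₀ b₀ | M.merge₁ Y (root? Y) a₁ b₁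
        ...     | σ , _ , jσ | τ , _ , jτ = out σ , out τ ,
          within 3ℚ (cong (_+ wt g) (cong₂ _+_ (out-link₁ σ) (out-link₁ τ))) (begin
            link₁ u σ + link₁ u τ + wt g                              ≤⟨ +-mono-≤ (+-mono-≤ jσ jτ) hg ⟩
            (δ + (A₀ + B₀)) + (δ + (A₁ + B₁)) + (wt g′ + δ)           ≡⟨ cong (_+ (wt g′ + δ)) (pair-sum δ A₀ B₀ δ A₁ B₁) ⟩
            ((δ + δ) + ((A₀ + A₁) + (B₀ + B₁))) + (wt g′ + δ)         ≡⟨ absorb-right (δ + δ) (A₀ + A₁) (B₀ + B₁) (wt g′) δ ⟩
            (δ + δ + δ) + ((A₀ + A₁) + ((B₀ + B₁) + wt g′))           ≤⟨ budget 3ℚ {δ} {cA} {cB} (≤-reflexive (sym (three δ))) hA hB ⟩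
            3ℚ * (δ + (cA + cB))                                      ∎)
          where
          A₀ = link₂ u a₀
          A₁ = link₂ u a₁
          B₀ = link₁ y b₀
          B₁ = link₁ y b₁
        pairJ X Y cov g | inj₂ (g′ , wt≡) with A.pairJ X Y cov g′ | B.pairK X Y cov
        ...   | a₀ , a₁ , hA | b₀ , b₁ , hB with M.merge₂ X (root? X) a₀ b₀ | M.merge₂ Y (root? Y) a₁ b₁
        ...     | σ , jσ | τ , jτ = out σ , out τ ,
          within 3ℚ (cong (_+ wt g) (cong₂ _+_ (out-link₁ σ) (out-link₁ τ))) (begin
            link₁ u σ + link₁ u τ + wt g                              ≤⟨ +-mono-≤ (+-mono-≤ jσ jτ) (≤-reflexive wt≡) ⟩
            (dX + (A₀ + B₀)) + (dY + (A₁ + B₁)) + wt g′               ≡⟨ cong (_+ wt g′) (pair-sum dX A₀ B₀ dY A₁ B₁) ⟩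
            ((dX + dY) + ((A₀ + A₁) + (B₀ + B₁))) + wt g′             ≡⟨ absorb-left (dX + dY) (A₀ + A₁) (B₀ + B₁) (wt g′) ⟩
            (dX + dY) + ((A₀ + A₁ + wt g′) + (B₀ + B₁))               ≤⟨ budget 3ℚ {δ} {cA} {cB} (charges cov) hA hB ⟩
            3ℚ * (δ + (cA + cB))                                      ∎)
          where
          dX = charge δ (root? X)
          dY = charge δ (root? Y)
          A₀ = link₁ u a₀
          A₁ = link₁ u a₁
          B₀ = link₂ y b₀
          B₁ = link₂ y b₁

        soloK : ∀ X → Σ (Part (e ∷ F) u X) λ σ → link₂ u σ ≤ 2ℚ * cost c (e ∷ F)
        soloK X with A.soloK X | B.soloK X
        ... | a , hA | b , hB with M.merge₁ X (root? X) a b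
        ...   | σ , kσ , _ = out σ , within 2ℚ (out-link₂ σ) (begin
          link₂ u σ                                       ≤⟨ kσ ⟩
          charge δ (root? X) + (link₂ u a + link₂ y b)    ≤⟨ budget 2ℚ {δ} {cA} {cB} (charge≤2δ X) hA hB ⟩
          2ℚ * (δ + (cA + cB))                            ∎)

        soloJ : ∀ X (g : OptEdge (e ∷ F)) → Σ (Part (e ∷ F) u X) λ σ → link₁ u σ + wt g ≤ 2ℚ * cost c (e ∷ F)
        soloJ X g with classify g
        ... | inj₁ (g′ , hg) with A.soloK X | B.soloJ X g′
        ...   | a , hA | b , hB with M.merge₁ X (root? X) a b
        ...     | σ , _ , jσ = out σ , within 2ℚ (cong (_+ wt g) (out-link₁ σ)) (begin
          link₁ u σ + wt g                                ≤⟨ +-mono-≤ jσ hg ⟩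
          (δ + (link₂ u a + link₁ y b)) + (wt g′ + δ)     ≡⟨ absorb-right δ (link₂ u a) (link₁ y b) (wt g′) δ ⟩
          (δ + δ) + (link₂ u a + (link₁ y b + wt g′))     ≤⟨ budget 2ℚ {δ} {cA} {cB} (≤-reflexive (sym (two δ))) hA hB ⟩
          2ℚ * (δ + (cA + cB))                            ∎)
        soloJ X g | inj₂ (g′ , wt≡) with A.soloJ X g′ | B.soloK X
        ...   | a , hA | b , hB with M.merge₂ X (root? X) a b
        ...     | σ , jσ = out σ , within 2ℚ (cong (_+ wt g) (out-link₁ σ)) (begin
          link₁ u σ + wt g                                ≤⟨ +-mono-≤ jσ (≤-reflexive wt≡) ⟩
          (d + (link₁ u a + link₂ y b)) + wt g′           ≡⟨ absorb-left d (link₁ u a) (link₂ y b) (wt g′) ⟩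
          d + ((link₁ u a + wt g′) + link₂ y b)           ≤⟨ budget 2ℚ {δ} {cA} {cB} (charge≤2δ X) hA hB ⟩
          2ℚ * (δ + (cA + cB))                            ∎)
          where
          d = charge δ (root? X)

  edgeAt : ∀ F u → (∀ g → g ∈ₗ F → ¬ EndOf g u) ⊎ Σ (Edge n) λ e → Σ (Fin n) λ y → e ∈ₗ F × Joins e u y
  edgeAt [] u = inj₁ (λ _ ())
  edgeAt (g ∷ F) u with end₁ g ≟ u | end₂ g ≟ u
  ... | yes p | _ = inj₂ (g , end₂ g , here refl , inj₁ (p , refl))
  ... | no _ | yes q = inj₂ (g , end₁ g , here refl , inj₂ (refl , q))
  ... | no ¬p | no ¬q with edgeAt F u
  ...   | inj₁ untouched = inj₁ λ { g′ (here refl) → [ ¬p , ¬q ] ; g′ (there g∈) → untouched g′ g∈ }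
  ...   | inj₂ (e , y , e∈ , joins) = inj₂ (e , y , there e∈ , joins)

  bounds : ∀ {k} F u → length F ℕ.< k → Bounds F u
  bounds {suc k} F u len with edgeAt F u
  ... | inj₁ untouched = Isolated.bounds untouched
  ... | inj₂ (e , y , e∈ , joins) with ∈-∃++ e∈
  ...   | xs , ys , refl = bounds-↭ (↭-shift e xs ys) (split (reachable? (xs ++ ys) u y))
    where
    open Step {xs ++ ys} {e} {u} {y} joins
    shorter : length (xs ++ ys) ℕ.< k
    shorter = subst (ℕ._≤ k) (List.length-++-sucʳ xs e ys) (ℕP.≤-pred len)
    split : Dec (Reach (xs ++ ys) u y) → Bounds (e ∷ xs ++ ys) u
    split (yes u~y) = Cycle.bounds u~y (bounds (xs ++ ys) u shorter)
    split (no u≁y) = Bridge.bounds u≁y (bounds FA u (ℕP.≤-<-trans (List.length-filter near? (xs ++ ys)) shorter))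
                                       (bounds FB y (ℕP.≤-<-trans (List.length-filter _ (xs ++ ys)) shorter))
      where open Bridge u≁y using (FA; FB; near?)

  bounds-of : ∀ F u → Bounds F u
  bounds-of F u = bounds F u (ℕP.n<1+n (length F))

  module Assembly {ex : Edge n} {vL vR : Fin n} (jx : Joins ex vL vR) {VL VR : Subset n} {TL TR : List (Edge n)}
                  (cap : VL ∩ VR ≡ ⊥) (cup : VL ∪ VR ≡ ⊤) (vL∈ : vL ∈ VL) (vR∈ : vR ∈ VR)
                  (stL : SpanningTree VL TL) (stR : SpanningTree VR TR) where

    wx = w c ex
    cL = cost c TL
    cR = cost c TR

    toL : ∀ {v} → v ∈ VL → Reach TL vL v
    toL v∈ = SpanningTree.connected stL vL _ vL∈ v∈

    toR : ∀ {v} → v ∈ VR → Reach TR vR v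
    toR v∈ = SpanningTree.connected stR vR _ vR∈ v∈

    fromL : ∀ {v} → Reach TL vL v → v ∈ VL
    fromL = walk-inside (SpanningTree.inside₁ stL) (SpanningTree.inside₂ stL) vL∈

    fromR : ∀ {v} → Reach TR vR v → v ∈ VR
    fromR = walk-inside (SpanningTree.inside₁ stR) (SpanningTree.inside₂ stR) vR∈

    sides-apart : ∀ {v} → v ∈ VL → v ∈ VR → Void
    sides-apart v∈L v∈R = ∉⊥ (subst (_ ∈_) cap (x∈p∩q⁺ (v∈L , v∈R)))

    sides-cover : ∀ v → v ∈ VL ⊎ v ∈ VR
    sides-cover v = x∈p∪q⁻ VL VR (subst (v ∈_) (sym cup) ∈⊤)

    module J (X : Subset n) =
      Merge {Colour TL vL X} {Colour TR vR X} (λ (_ , rL) (_ , rR) → sides-apart (fromL rL) (fromR rR))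
            vL vR (λ (_ , rR) → sides-apart vL∈ (fromR rR))

    span : ∀ X (σL : Part TL vL X) (σR : Part TR vR X) → Σ (List (Edge n)) λ F → SpanningTree X F
           × (cost c F ≤ wx + (link₁ vL σL + link₁ vR σR)) × (Absent (Colour TL vL X) → cost c F ≤ link₁ vR σR)
    span X σL σR = edgesOf σ , state-spans σ [ proj₁ , proj₁ ] fromX , through-ex , alone
      where
      merged = J.merge₀ X σL σR
      σ = proj₁ merged
      alone = proj₂ (proj₂ merged)
      through-ex : cost c (edgesOf σ) ≤ wx + (link₁ vL σL + link₁ vR σR)
      through-ex = subst (λ d → cost c (edgesOf σ) ≤ d + (link₁ vL σL + link₁ vR σR))
                         (sym (weight-joins {e = ex} jx)) (proj₁ (proj₂ merged))
      fromX : ∀ {v} → v ∈ X → J.Target X v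
      fromX v∈X = [ (λ v∈L → inj₁ (v∈X , toL v∈L)) , (λ v∈R → inj₂ (v∈X , toR v∈R)) ] (sides-cover _)

    mst-joined : ∀ {X Tx} → MST c X Tx → ∀ σL σR → cost c Tx ≤ wx + (link₁ vL σL + link₁ vR σR)
    mst-joined {X} mst σL σR = let (F , tree , joined , _) = span X σL σR in ≤-trans (MST.minimal mst F tree) joined

    mst-alone : ∀ {X Tx} → MST c X Tx → ∀ σL σR → Absent (Colour TL vL X) → cost c Tx ≤ link₁ vR σR
    mst-alone {X} mst σL σR noL = let (F , tree , _ , alone) = span X σL σR in ≤-trans (MST.minimal mst F tree) (alone noL)

    module BlueLeft {Vb : Subset n} (VL⊆Vb : VL ⊆ Vb) where
      wholeL : Part TL vL Vb
      wholeL = inj₂ (record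
        { nodes = VL ; edges = TL ; tree = stL ; sound = λ v∈ → VL⊆Vb v∈ , toL v∈ ; complete = λ (_ , r) → fromL r
        ; port₁ = vL ; port₂ = vL ; port₁∈ = vL∈ ; port₂∈ = vL∈ ; anchored = λ _ → refl , refl })

      wholeL-cost : link₁ vL wholeL ≡ cL
      wholeL-cost = trans (cong (cL +_) (diag vL)) (+-identityʳ cL)

      noRedL : Absent (Colour TL vL (∁ Vb))
      noRedL (v∈∁ , r) = x∈∁p⇒x∉p v∈∁ (VL⊆Vb (fromL r))

    module Colouring (Vb : Subset n) {Tb Tr : List (Edge n)} (mb : MST c Vb Tb) (mr : MST c (∁ Vb) Tr) where
      open ≤-Reasoning

      cov : Covers Vb (∁ Vb)
      cov v with v ∈? Vb
      ... | yes v∈ = inj₁ v∈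
      ... | no v∉ = inj₂ (x∉p⇒x∈∁p v∉)

      mL = maxW c TL
      mR = maxW c TR
      gL = proj₁ (heaviest TL)
      gR = proj₁ (heaviest TR)
      module BL = Bounds (bounds-of TL vL)
      module BR = Bounds (bounds-of TR vR)

      partA : cost c Tb + cost c Tr ≤ 3ℚ * (wx + (cL + cR)) - (mL + wx + mR)
      partA with BL.pairJ Vb (∁ Vb) cov gL | BR.pairJ Vb (∁ Vb) cov gR
      ... | bL , rL , hL | bR , rR , hR = ≤-minus (cost c Tb + cost c Tr) (mL + wx + mR) (begin
        cost c Tb + cost c Tr + (mL + wx + mR)
          ≤⟨ +-monoˡ-≤ (mL + wx + mR) (+-mono-≤ (mst-joined mb bL bR) (mst-joined mr rL rR)) ⟩
        (wx + (JbL + JbR)) + (wx + (JrL + JrR)) + (mL + wx + mR)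
          ≡⟨ rearrange wx JbL JbR JrL JrR mL mR ⟩
        (wx + wx + wx) + ((JbL + JrL + mL) + (JbR + JrR + mR))
          ≤⟨ budget 3ℚ {wx} {cL} {cR} (≤-reflexive (sym (three wx)))
                    (subst (λ m → JbL + JrL + m ≤ 3ℚ * cL) (proj₂ (heaviest TL)) hL)
                    (subst (λ m → JbR + JrR + m ≤ 3ℚ * cR) (proj₂ (heaviest TR)) hR) ⟩
        3ℚ * (wx + (cL + cR)) ∎)
        where
        JbL = link₁ vL bL
        JrL = link₁ vL rL
        JbR = link₁ vR bR
        JrR = link₁ vR rR
        rearrange : ∀ x bL bR rL rR mL mR →
                    (x + (bL + bR)) + (x + (rL + rR)) + (mL + x + mR) ≡ (x + x + x) + ((bL + rL + mL) + (bR + rR + mR))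
        rearrange = solve-∀ ℚ-ring

      partB-one : ∀ {X Tx} → MST c X Tx → (Σ (Part TL vL X) λ σ → link₁ vL σ + wt gL ≤ 2ℚ * cL) →
                  (Σ (Part TR vR X) λ σ → link₁ vR σ + wt gR ≤ 2ℚ * cR) → cost c Tx ≤ 2ℚ * (wx + (cL + cR)) - (mL + wx + mR)
      partB-one {Tx = Tx} mst (σL , hL) (σR , hR) = ≤-minus (cost c Tx) (mL + wx + mR) (begin
        cost c Tx + (mL + wx + mR)                ≤⟨ +-monoˡ-≤ (mL + wx + mR) (mst-joined mst σL σR) ⟩
        (wx + (JL + JR)) + (mL + wx + mR)         ≡⟨ rearrange wx JL JR mL mR ⟩
        (wx + wx) + ((JL + mL) + (JR + mR))       ≤⟨ budget 2ℚ {wx} {cL} {cR} (≤-reflexive (sym (two wx)))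
                                                       (subst (λ m → JL + m ≤ 2ℚ * cL) (proj₂ (heaviest TL)) hL)
                                                       (subst (λ m → JR + m ≤ 2ℚ * cR) (proj₂ (heaviest TR)) hR) ⟩
        2ℚ * (wx + (cL + cR))                     ∎)
        where
        JL = link₁ vL σL
        JR = link₁ vR σR
        rearrange : ∀ x L R mL mR → (x + (L + R)) + (mL + x + mR) ≡ (x + x) + ((L + mL) + (R + mR))
        rearrange = solve-∀ ℚ-ring

      partB : cost c Tb ⊔ cost c Tr ≤ 2ℚ * (wx + (cL + cR)) - (mL + wx + mR)
      partB = ⊔-lub (partB-one mb (BL.soloJ Vb gL) (BR.soloJ Vb gR)) (partB-one mr (BL.soloJ (∁ Vb) gL) (BR.soloJ (∁ Vb) gR))

      shift-minus : ∀ a b m → (a + b) - m ≡ a + (b - m)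
      shift-minus a b m = +-assoc a b (- m)

      partC : VL ⊆ Vb → cost c Tb + cost c Tr ≤ cL + wx + (3ℚ * cR - mR)
      partC VL⊆Vb with BR.pairJ Vb (∁ Vb) cov gR
      ... | bR , rR , hR = ≤-trans (≤-minus (cost c Tb + cost c Tr) mR (begin
        cost c Tb + cost c Tr + mR
          ≤⟨ +-monoˡ-≤ mR (+-mono-≤ (mst-joined mb wholeL bR) (mst-alone mr (inj₁ noRedL) rR noRedL)) ⟩
        (wx + (link₁ vL wholeL + JbR)) + JrR + mR
          ≡⟨ cong (λ l → (wx + (l + JbR)) + JrR + mR) wholeL-cost ⟩
        (wx + (cL + JbR)) + JrR + mR
          ≡⟨ rearrange wx cL JbR JrR mR ⟩
        (cL + wx) + (JbR + JrR + mR)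
          ≤⟨ +-monoʳ-≤ (cL + wx) (subst (λ m → JbR + JrR + m ≤ 3ℚ * cR) (proj₂ (heaviest TR)) hR) ⟩
        (cL + wx) + 3ℚ * cR ∎)) (≤-reflexive (shift-minus (cL + wx) (3ℚ * cR) mR))
        where
        open BlueLeft VL⊆Vb
        JbR = link₁ vR bR
        JrR = link₁ vR rR
        rearrange : ∀ x l b r m → (x + (l + b)) + r + m ≡ (l + x) + (b + r + m)
        rearrange = solve-∀ ℚ-ring

      partD : VL ⊆ Vb → cost c Tb ⊔ cost c Tr ≤ cL + wx + (2ℚ * cR - mR)
      partD VL⊆Vb with BR.soloJ Vb gR | BR.soloJ (∁ Vb) gR
      ... | bR , hb | rR , hr = ⊔-lub
        (≤-trans (≤-minus (cost c Tb) mR (begin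
          cost c Tb + mR                          ≤⟨ +-monoˡ-≤ mR (mst-joined mb wholeL bR) ⟩
          (wx + (link₁ vL wholeL + JbR)) + mR     ≡⟨ cong (λ l → (wx + (l + JbR)) + mR) wholeL-cost ⟩
          (wx + (cL + JbR)) + mR                  ≡⟨ rearrange wx cL JbR mR ⟩
          (cL + wx) + (JbR + mR)                  ≤⟨ +-monoʳ-≤ (cL + wx) (subst (λ m → JbR + m ≤ 2ℚ * cR) (proj₂ (heaviest TR)) hb) ⟩
          (cL + wx) + 2ℚ * cR                     ∎)) (≤-reflexive (shift-minus (cL + wx) (2ℚ * cR) mR)))
        (≤-trans (≤-minus (cost c Tr) mR (begin
          cost c Tr + mR                          ≤⟨ +-monoˡ-≤ mR (mst-alone mr (inj₁ noRedL) rR noRedL) ⟩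
          link₁ vR rR + mR                        ≤⟨ subst (λ m → link₁ vR rR + m ≤ 2ℚ * cR) (proj₂ (heaviest TR)) hr ⟩
          2ℚ * cR                                 ≤⟨ x≤y+x (2ℚ * cR) (+-mono-≤ (cost-nonneg TL) (weight-nonneg ex)) ⟩
          (cL + wx) + 2ℚ * cR                     ∎)) (≤-reflexive (shift-minus (cL + wx) (2ℚ * cR) mR)))
        where
        open BlueLeft VL⊆Vb
        JbR = link₁ vR bR
        rearrange : ∀ x l b m → (x + (l + b)) + m ≡ (l + x) + (b + m)
        rearrange = solve-∀ ℚ-ring

theorem1 : ∀ (n : ℕ) (c : Weight n) → IsMetric c →
    ∀ (T : List (Edge n)) → MST c ⊤ T →
    ∀ (Vb : Subset n) (Tb Tr : List (Edge n)) → MST c Vb Tb → MST c (∁ Vb) Tr →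
    ∀ (ex : Edge n) → ex ∈ₗ T → (∀ e → e ∈ₗ T → w c e ≤ w c ex) →
    ∀ (vL vR : Fin n) → Joins ex vL vR →
    ∀ (VL VR : Subset n) (TL TR : List (Edge n)) →
    VL ∩ VR ≡ ⊥ → VL ∪ VR ≡ ⊤ → vL ∈ VL → vR ∈ VR →
    T ↭ (ex ∷ (TL ++ TR)) → SpanningTree VL TL → SpanningTree VR TR →
    ((cost c Tb + cost c Tr ≤ 3ℚ * cost c T - (maxW c TL + w c ex + maxW c TR))
     × (cost c Tb ⊔ cost c Tr ≤ 2ℚ * cost c T - (maxW c TL + w c ex + maxW c TR))
     × (VL ⊆ Vb →
          (cost c Tb + cost c Tr ≤ cost c TL + w c ex + (3ℚ * cost c TR - maxW c TR))
          × (cost c Tb ⊔ cost c Tr ≤ cost c TL + w c ex + (2ℚ * cost c TR - maxW c TR))))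
theorem1 n c metric T _ Vb Tb Tr mb mr ex _ _ vL vR jx VL VR TL TR cap cup vL∈ vR∈ T↭ stL stR =
  inT 3ℚ partA , inT 2ℚ partB , λ VL⊆Vb → partC VL⊆Vb , partD VL⊆Vb
  where
  open WithMetric c metric
  open Assembly {ex = ex} jx cap cup vL∈ vR∈ stL stR
  open Colouring Vb mb mr
  cost-T : cost c T ≡ wx + (cL + cR)
  cost-T = trans (cost-↭ T↭) (cong (wx +_) (cost-++ TL TR))
  inT : ∀ m {x} → x ≤ m * (wx + (cL + cR)) - (mL + wx + mR) → x ≤ m * cost c T - (mL + wx + mR)
  inT m {x} = subst (λ C → x ≤ m * C - (mL + wx + mR)) (sym cost-T)
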